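{- For every type $T$ (in the type language described in the context): $T$ is in weak head normal form if and only if $T$ is irreducible, i.e. there is no type $U$ with $T \longrightarrow U$.
   Context: Kinds: proper kinds are $\mathsf{s}$ (session) and $\mathsf{t}$ (functional); kinds are $\kappa ::= \mathsf{s} \mid \mathsf{t} \mid \kappa \Rightarrow \kappa$. Types are $T ::= \iota \mid \alpha \mid \lambda\alpha{:}\kappa.T \mid T\,T$ (application left-associative), where $\alpha$ ranges over type variables and the type constants $\iota$ are: $\rightarrow$, record and variant constants $\{\overline{l_i}\}$, $\langle\overline{l_i}\rangle$ (one per finite set of labels), $\mu_\kappa$ and $\forall_\kappa$ (one per kind $\kappa$), $\mathsf{Skip}$, $\mathsf{End}$, $?$, $!$ (written $\sharp$ for either), sequential composition $;$, choice constants $\&\{\overline{l_i}\}$, $\oplus\{\overline{l_i}\}$ (written $\odot\{\overline{l_i}\}$ for either), and $\mathsf{Dual}$. Notation: $T;U$ is $(;\,T)\,U$; $\sharp T$ is the application of $?$ or $!$ to $T$; $\odot\{\overline{l_i:T_i}\}$ is $\odot\{\overline{l_i}\}\,T_1\cdots T_n$; $\mathsf{Dual}\,T$ is the application of $\mathsf{Dual}$ to $T$. $T[U/\alpha]$ is substitution of $U$ for the free occurrences of $\alpha$ in $T$. Renaming: fix a countable well-ordered set of variables $\upsilon_1,\upsilon_2,\ldots$. For a set $S$ of variables, $\mathrm{rename}_S(\iota)=\iota$, $\mathrm{rename}_S(\alpha)=\alpha$, $\mathrm{rename}_S(\lambda\alpha{:}\kappa.T)=\lambda\upsilon{:}\kappa.\mathrm{rename}_S(T[\upsilon/\alpha])$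 where $\upsilon$ is the least $\upsilon_i$ not in $S\cup \mathrm{fv}(\lambda\alpha{:}\kappa.T)$, and $\mathrm{rename}_S(T\,U)=\mathrm{rename}_{S\cup\mathrm{fv}(U)}(T)\,\mathrm{rename}_S(U)$; $\mathrm{rename}(T)=\mathrm{rename}_\emptyset(T)$. Convention: all types are assumed renamed, i.e. $T=\mathrm{rename}(T)$. Reduction $T\longrightarrow U$ is the least relation closed under: $\mathsf{Skip};T \longrightarrow T$; if $T\longrightarrow V$ then $T;U\longrightarrow V;U$; $(T;U);V\longrightarrow T;(U;V)$; $\mu_\kappa\,T\longrightarrow T\,(\mu_\kappa\,T)$; $(\lambda\alpha{:}\kappa.T)\,U\longrightarrow \mathrm{rename}(T[U/\alpha])$; if $T\longrightarrow U$ then $T\,V\longrightarrow U\,V$; $\mathsf{Dual}(T;U)\longrightarrow (\mathsf{Dual}\,T);(\mathsf{Dual}\,U)$; $\mathsf{Dual}\,\mathsf{Skip}\longrightarrow\mathsf{Skip}$; $\mathsf{Dual}\,\mathsf{End}\longrightarrow\mathsf{End}$; $\mathsf{Dual}(?T)\longrightarrow !T$; $\mathsf{Dual}(!T)\longrightarrow ?T$; $\mathsf{Dual}(\&\{\overline{l_i:T_i}\})\longrightarrow\oplus\{\overline{l_i:\mathsf{Dual}\,T_i}\}$; $\mathsf{Dual}(\oplus\{\overline{l_i:T_i}\})\longrightarrow\&\{\overline{l_i:\mathsf{Dual}\,T_i}\}$; if $T\longrightarrow U$ then $\mathsf{Dual}\,T\longrightarrow\mathsf{Dual}\,U$; $\mathsf{Dual}(\mathsf{Dual}(\alpha\,T_1\cdots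 T_m))\longrightarrow \alpha\,T_1\cdots T_m$ ($m\ge 0$). Weak head normal form ($T$ is whnf) is the least predicate closed under: every constant $\iota$ is whnf; $\iota\,T_1\cdots T_m$ is whnf if $m\ge1$ and $\iota$ is not $;$, not $\mu_\kappa$, not $\mathsf{Dual}$; $;\,T$ is whnf; $;\,T_1\cdots T_m$ is whnf if $m\ge 2$, $T_1$ is whnf and $T_1$ is neither $\mathsf{Skip}$ nor of the form $U;V$; $\alpha\,T_1\cdots T_m$ is whnf for $m\ge 0$; $\lambda\alpha{:}\kappa.T$ is whnf; $\mathsf{Dual}\,T_1\cdots T_m$ is whnf if $m\ge 1$, $T_1$ is whnf and $T_1$ is not $\mathsf{Skip}$, $\mathsf{End}$, $\sharp U$, $U;V$, $\odot\{\overline{l_i:U_i}\}$, or $\mathsf{Dual}(\alpha\,U_1\cdots U_n)$. -}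

module Defs where

open import Data.Nat using (ℕ; zero; suc; _+_; _≟_)
open import Data.Nat.Base using (_≡ᵇ_)
open import Data.Bool using (Bool; true; false; if_then_else_)
open import Data.List using (List; []; _∷_; _++_; length; map; filter)
open import Data.Bool.ListAction using (any)
open import Data.Product using (_×_; Σ)
open import Relation.Nullary using (¬_; ¬?)
open import Relation.Binary.PropositionalEquality using (_≡_; _≢_)

data Kind : Set where
  s t  : Kind
  _⇒_  : Kind → Kind → Kind

-- Variables (type variables and the well-ordered set υ₁, υ₂, … are the same set, ℕ)
Var : Set
Var = ℕ

Label : Set
Label = ℕ

data Const : Set where
  arrowC   : Const
  recordC  : List Label → Const
  variantC : List Label → Const
  muC      : Kind → Const
  forallC  : Kind → Const
  skipC    : Const
  endC     : Const
  recvC    : Const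
  sendC    : Const
  semiC    : Const
  extC     : List Label → Const
  intC     : List Label → Const
  dualC    : Const

data Ty : Set where
  con : Const → Ty
  var : Var → Ty
  lam : Var → Kind → Ty → Ty
  app : Ty → Ty → Ty

apps : Ty → List Ty → Ty
apps T []       = T
apps T (U ∷ Us) = apps (app T U) Us

_⨟_ : Ty → Ty → Ty
T ⨟ U = app (app (con semiC) T) U

Dual : Ty → Ty
Dual T = app (con dualC) T

fv : Ty → List Var
fv (con c)     = []
fv (var α)     = α ∷ []
fv (lam α κ T) = filter (λ x → ¬? (x ≟ α)) (fv T)
fv (app T U)   = fv T ++ fv U

subst : Ty → Ty → Var → Ty
subst (con c)     U α = con c
subst (var β)     U α = if β ≡ᵇ α then U else var β
subst (lam β κ T) U α = if β ≡ᵇ α then lam β κ T else lam β κ (subst T U α)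
subst (app T₁ T₂) U α = app (subst T₁ U α) (subst T₂ U α)

member : ℕ → List ℕ → Bool
member k xs = any (k ≡ᵇ_) xs

leastFrom : ℕ → ℕ → List ℕ → ℕ
leastFrom zero    k xs = k
leastFrom (suc n) k xs = if member k xs then leastFrom n (suc k) xs else k

leastNotIn : List ℕ → ℕ
leastNotIn xs = leastFrom (suc (length xs)) 0 xs

size : Ty → ℕ
size (con c)     = 1
size (var α)     = 1
size (lam α κ T) = suc (size T)
size (app T U)   = suc (size T + size U)

-- rename_S, with fuel (size T suffices since variable-for-variable substitution
-- preserves size)
renameF : ℕ → List Var → Ty → Ty
renameF zero    S T           = T
renameF (suc n) S (con c)     = con c
renameF (suc n) S (var α)     = var α
renameF (suc n) S (lam α κ T) =
  let υ = leastNotIn (S ++ fv (lam α κ T)) in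
  lam υ κ (renameF n S (subst T (var υ) α))
renameF (suc n) S (app T U)   = app (renameF n (S ++ fv U) T) (renameF n S U)

rename : Ty → Ty
rename T = renameF (size T) [] T

infix 4 _⟶_
data _⟶_ : Ty → Ty → Set where
  r-skip   : ∀ {T} → (con skipC ⨟ T) ⟶ T
  r-seq    : ∀ {T U V} → T ⟶ V → (T ⨟ U) ⟶ (V ⨟ U)
  r-assoc  : ∀ {T U V} → ((T ⨟ U) ⨟ V) ⟶ (T ⨟ (U ⨟ V))
  r-mu     : ∀ {κ T} → app (con (muC κ)) T ⟶ app T (app (con (muC κ)) T)
  r-beta   : ∀ {α κ T U} → app (lam α κ T) U ⟶ rename (subst T U α)
  r-app    : ∀ {T U V} → T ⟶ U → app T V ⟶ app U V
  r-dseq   : ∀ {T U} → Dual (T ⨟ U) ⟶ (Dual T ⨟ Dual U)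
  r-dskip  : Dual (con skipC) ⟶ con skipC
  r-dend   : Dual (con endC) ⟶ con endC
  r-drecv  : ∀ {T} → Dual (app (con recvC) T) ⟶ app (con sendC) T
  r-dsend  : ∀ {T} → Dual (app (con sendC) T) ⟶ app (con recvC) T
  r-dext   : ∀ {ls Ts} → length Ts ≡ length ls →
             Dual (apps (con (extC ls)) Ts) ⟶ apps (con (intC ls)) (map Dual Ts)
  r-dint   : ∀ {ls Ts} → length Ts ≡ length ls →
             Dual (apps (con (intC ls)) Ts) ⟶ apps (con (extC ls)) (map Dual Ts)
  r-dual   : ∀ {T U} → T ⟶ U → Dual T ⟶ Dual U
  r-dd     : ∀ {α Ts} → Dual (Dual (apps (var α) Ts)) ⟶ apps (var α) Ts

data IsSeq : Ty → Set where
  isSeq : ∀ {U V} → IsSeq (U ⨟ V)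

data IsDualBlocked : Ty → Set where
  b-skip   : IsDualBlocked (con skipC)
  b-end    : IsDualBlocked (con endC)
  b-recv   : ∀ {U} → IsDualBlocked (app (con recvC) U)
  b-send   : ∀ {U} → IsDualBlocked (app (con sendC) U)
  b-seq    : ∀ {U V} → IsDualBlocked (U ⨟ V)
  b-ext    : ∀ {ls Us} → length Us ≡ length ls → IsDualBlocked (apps (con (extC ls)) Us)
  b-int    : ∀ {ls Us} → length Us ≡ length ls → IsDualBlocked (apps (con (intC ls)) Us)
  b-dvar   : ∀ {α Us} → IsDualBlocked (Dual (apps (var α) Us))

data Whnf : Ty → Set where
  w-con    : ∀ ι → Whnf (con ι)
  w-capp   : ∀ ι T Ts → ι ≢ semiC → (∀ κ → ι ≢ muC κ) → ι ≢ dualC →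
             Whnf (apps (con ι) (T ∷ Ts))
  w-semi1  : ∀ T → Whnf (app (con semiC) T)
  w-semi   : ∀ T₁ T₂ Ts → Whnf T₁ → T₁ ≢ con skipC → ¬ IsSeq T₁ →
             Whnf (apps (con semiC) (T₁ ∷ T₂ ∷ Ts))
  w-var    : ∀ α Ts → Whnf (apps (var α) Ts)
  w-lam    : ∀ α κ T → Whnf (lam α κ T)
  w-dual   : ∀ T₁ Ts → Whnf T₁ → ¬ IsDualBlocked T₁ →
             Whnf (apps (con dualC) (T₁ ∷ Ts))

-- Every type is either in whnf or has a redex (progress), and no whnf reduces.
-- Every reduction rule fires at the head of the application spine, so both
-- facts are case analyses on the head and its first arguments. The one
-- non-syntactic side condition is whether Dual T fires: that depends on the
-- head of T and on the number of arguments it is applied to, and becomes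
-- decidable once T is flattened into its head and spine.
module Submission where

open import Defs
open import Data.Empty using (⊥)
open import Data.List using (List; []; _∷_; _++_; _∷ʳ_; length)
open import Data.List.Properties using (++-assoc; ++-identityʳ)
open import Data.Nat using (_≟_)
open import Data.Product using (Σ; _,_; proj₂)
open import Function.Bundles using (_⇔_; mk⇔)
open import Relation.Binary.PropositionalEquality
  using (_≡_; _≢_; refl; sym; trans; cong) renaming (subst to transport)
open import Relation.Nullary using (¬_; Dec; yes; no)
open import Relation.Nullary.Decidable using (map′)

Reducible : Ty → Set
Reducible T = Σ Ty (λ U → T ⟶ U)

Irreducible : Ty → Set
Irreducible T = ∀ {U} → ¬ (T ⟶ U)

headOf : Ty → Ty
headOf (con c)     = con c
headOf (var α)     = var α
headOf (lam α κ T) = lam α κ T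
headOf (app T U)   = headOf T

spine : Ty → List Ty
spine (app T U) = spine T ∷ʳ U
spine _         = []

apps-∷ʳ : ∀ X Ts C → apps X (Ts ∷ʳ C) ≡ app (apps X Ts) C
apps-∷ʳ X []       C = refl
apps-∷ʳ X (Y ∷ Ts) C = apps-∷ʳ (app X Y) Ts C

apps-headOf-spine : ∀ T → apps (headOf T) (spine T) ≡ T
apps-headOf-spine (con c)     = refl
apps-headOf-spine (var α)     = refl
apps-headOf-spine (lam α κ T) = refl
apps-headOf-spine (app T U)   =
  trans (apps-∷ʳ (headOf T) (spine T) U) (cong (λ X → app X U) (apps-headOf-spine T))

headOf-apps : ∀ X Us → headOf (apps X Us) ≡ headOf X
headOf-apps X []       = refl
headOf-apps X (Y ∷ Us) = headOf-apps (app X Y) Us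

spine-apps : ∀ X Us → spine (apps X Us) ≡ spine X ++ Us
spine-apps X []       = sym (++-identityʳ (spine X))
spine-apps X (Y ∷ Us) = trans (spine-apps (app X Y) Us) (++-assoc (spine X) (Y ∷ []) Us)

IsVar : Ty → Set
IsVar T = Σ Var (λ α → T ≡ var α)

isVar? : ∀ T → Dec (IsVar T)
isVar? (con c)     = no λ ()
isVar? (var α)     = yes (α , refl)
isVar? (lam α κ T) = no λ ()
isVar? (app T U)   = no λ ()

BlockingSpine : Ty → List Ty → Set
BlockingSpine (con skipC)     Us       = length Us ≡ 0
BlockingSpine (con endC)      Us       = length Us ≡ 0
BlockingSpine (con recvC)     Us       = length Us ≡ 1
BlockingSpine (con sendC)     Us       = length Us ≡ 1
BlockingSpine (con semiC)     Us       = length Us ≡ 2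
BlockingSpine (con (extC ls)) Us       = length Us ≡ length ls
BlockingSpine (con (intC ls)) Us       = length Us ≡ length ls
BlockingSpine (con dualC)     (X ∷ []) = IsVar (headOf X)
BlockingSpine _               _        = ⊥

blockingSpine? : ∀ H Us → Dec (BlockingSpine H Us)
blockingSpine? (con arrowC)       Us          = no λ ()
blockingSpine? (con (recordC _))  Us          = no λ ()
blockingSpine? (con (variantC _)) Us          = no λ ()
blockingSpine? (con (muC _))      Us          = no λ ()
blockingSpine? (con (forallC _))  Us          = no λ ()
blockingSpine? (con skipC)        Us          = length Us ≟ 0
blockingSpine? (con endC)         Us          = length Us ≟ 0
blockingSpine? (con recvC)        Us          = length Us ≟ 1
blockingSpine? (con sendC)        Us          = length Us ≟ 1
blockingSpine? (con semiC)        Us          = length Us ≟ 2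
blockingSpine? (con (extC ls))    Us          = length Us ≟ length ls
blockingSpine? (con (intC ls))    Us          = length Us ≟ length ls
blockingSpine? (con dualC)        []          = no λ ()
blockingSpine? (con dualC)        (X ∷ [])    = isVar? (headOf X)
blockingSpine? (con dualC)        (_ ∷ _ ∷ _) = no λ ()
blockingSpine? (var α)            Us          = no λ ()
blockingSpine? (lam α κ T)        Us          = no λ ()
blockingSpine? (app T U)          Us          = no λ ()

blockingSpine⇒blocked : ∀ H Us → BlockingSpine H Us → IsDualBlocked (apps H Us)
blockingSpine⇒blocked (con skipC)     []              _       = b-skip
blockingSpine⇒blocked (con endC)      []              _       = b-end
blockingSpine⇒blocked (con recvC)     (_ ∷ [])        _       = b-recv
blockingSpine⇒blocked (con sendC)     (_ ∷ [])        _       = b-send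
blockingSpine⇒blocked (con semiC)     (_ ∷ _ ∷ [])    _       = b-seq
blockingSpine⇒blocked (con (extC ls)) Us              e       = b-ext {ls} {Us} e
blockingSpine⇒blocked (con (intC ls)) Us              e       = b-int {ls} {Us} e
blockingSpine⇒blocked (con dualC)     (X ∷ [])        (α , e) =
  transport (λ Y → IsDualBlocked (Dual Y))
    (transport (λ H → apps H (spine X) ≡ X) e (apps-headOf-spine X)) (b-dvar {α} {spine X})
blockingSpine⇒blocked (con skipC)     (_ ∷ _)         ()
blockingSpine⇒blocked (con endC)      (_ ∷ _)         ()
blockingSpine⇒blocked (con recvC)     []              ()
blockingSpine⇒blocked (con recvC)     (_ ∷ _ ∷ _)     ()
blockingSpine⇒blocked (con sendC)     []              ()
blockingSpine⇒blocked (con sendC)     (_ ∷ _ ∷ _)     ()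
blockingSpine⇒blocked (con semiC)     []              ()
blockingSpine⇒blocked (con semiC)     (_ ∷ [])        ()
blockingSpine⇒blocked (con semiC)     (_ ∷ _ ∷ _ ∷ _) ()
blockingSpine⇒blocked (con dualC)     []              ()
blockingSpine⇒blocked (con dualC)     (_ ∷ _ ∷ _)     ()
blockingSpine⇒blocked (con arrowC)       _ ()
blockingSpine⇒blocked (con (recordC _))  _ ()
blockingSpine⇒blocked (con (variantC _)) _ ()
blockingSpine⇒blocked (con (muC _))      _ ()
blockingSpine⇒blocked (con (forallC _))  _ ()
blockingSpine⇒blocked (var _)            _ ()
blockingSpine⇒blocked (lam _ _ _)        _ ()
blockingSpine⇒blocked (app _ _)          _ ()

blocked⇒blockingSpine : ∀ {U} → IsDualBlocked U → BlockingSpine (headOf U) (spine U)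
blocked⇒blockingSpine b-skip = refl
blocked⇒blockingSpine b-end  = refl
blocked⇒blockingSpine b-recv = refl
blocked⇒blockingSpine b-send = refl
blocked⇒blockingSpine b-seq  = refl
blocked⇒blockingSpine (b-ext {ls} {Us} e)
  rewrite headOf-apps (con (extC ls)) Us | spine-apps (con (extC ls)) Us = e
blocked⇒blockingSpine (b-int {ls} {Us} e)
  rewrite headOf-apps (con (intC ls)) Us | spine-apps (con (intC ls)) Us = e
blocked⇒blockingSpine (b-dvar {α} {Us}) = α , headOf-apps (var α) Us

isDualBlocked? : ∀ U → Dec (IsDualBlocked U)
isDualBlocked? U = map′ fromSpine blocked⇒blockingSpine (blockingSpine? (headOf U) (spine U))
  where
  fromSpine : BlockingSpine (headOf U) (spine U) → IsDualBlocked U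
  fromSpine b = transport IsDualBlocked (apps-headOf-spine U)
                  (blockingSpine⇒blocked (headOf U) (spine U) b)

blocked-Dual-reducible : ∀ {U} → IsDualBlocked U → Reducible (Dual U)
blocked-Dual-reducible b-skip  = _ , r-dskip
blocked-Dual-reducible b-end   = _ , r-dend
blocked-Dual-reducible b-recv  = _ , r-drecv
blocked-Dual-reducible b-send  = _ , r-dsend
blocked-Dual-reducible b-seq   = _ , r-dseq
blocked-Dual-reducible (b-ext {ls} {Us} e) = _ , r-dext {ls} {Us} e
blocked-Dual-reducible (b-int {ls} {Us} e) = _ , r-dint {ls} {Us} e
blocked-Dual-reducible (b-dvar {α} {Us}) = _ , r-dd {α} {Us}

-- The X for which app X Y can only reduce by reducing X.
data Rigid : Ty → Set where
  var : ∀ α → Rigid (var α)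
  app : ∀ {X Y} → X ≢ con semiC → Rigid (app X Y)

Rigid-app : ∀ {X} Y → Rigid X → Rigid (app X Y)
Rigid-app Y (var α) = app λ ()
Rigid-app Y (app _) = app λ ()

Rigid-apps : ∀ {X} Ys → Rigid X → Rigid (apps X Ys)
Rigid-apps []       ρ = ρ
Rigid-apps (Y ∷ Ys) ρ = Rigid-apps Ys (Rigid-app Y ρ)

app-irreducible : ∀ {X Y} → Rigid X → Irreducible X → Irreducible (app X Y)
app-irreducible (app ne) irr r-skip    = ne refl
app-irreducible (app ne) irr (r-seq _) = ne refl
app-irreducible (app ne) irr r-assoc   = ne refl
app-irreducible _        irr (r-app r) = irr r

apps-irreducible : ∀ {X} Ys → Rigid X → Irreducible X → Irreducible (apps X Ys)
apps-irreducible []       ρ irr = irr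
apps-irreducible (Y ∷ Ys) ρ irr =
  apps-irreducible Ys (Rigid-app Y ρ) (app-irreducible ρ irr)

con-app-irreducible : ∀ {ι T} → ι ≢ semiC → (∀ κ → ι ≢ muC κ) → ι ≢ dualC →
                      Irreducible (app (con ι) T)
con-app-irreducible _ ¬μ _  r-mu      = ¬μ _ refl
con-app-irreducible _ _  _  (r-app ())
con-app-irreducible _ _  ¬D r-dseq    = ¬D refl
con-app-irreducible _ _  ¬D r-dskip   = ¬D refl
con-app-irreducible _ _  ¬D r-dend    = ¬D refl
con-app-irreducible _ _  ¬D r-drecv   = ¬D refl
con-app-irreducible _ _  ¬D r-dsend   = ¬D refl
con-app-irreducible _ _  ¬D (r-dext _) = ¬D refl
con-app-irreducible _ _  ¬D (r-dint _) = ¬D refl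
con-app-irreducible _ _  ¬D (r-dual _) = ¬D refl
con-app-irreducible _ _  ¬D r-dd      = ¬D refl

seq-irreducible : ∀ {T U} → Irreducible T → T ≢ con skipC → ¬ IsSeq T →
                  Irreducible (T ⨟ U)
seq-irreducible irr ¬skip ¬seq r-skip    = ¬skip refl
seq-irreducible irr ¬skip ¬seq (r-seq r) = irr r
seq-irreducible irr ¬skip ¬seq r-assoc   = ¬seq isSeq
seq-irreducible irr ¬skip ¬seq (r-app (r-app ()))

Dual-irreducible : ∀ {T} → Irreducible T → ¬ IsDualBlocked T → Irreducible (Dual T)
Dual-irreducible irr ¬b (r-app ())
Dual-irreducible irr ¬b r-dseq     = ¬b b-seq
Dual-irreducible irr ¬b r-dskip    = ¬b b-skip
Dual-irreducible irr ¬b r-dend     = ¬b b-end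
Dual-irreducible irr ¬b r-drecv    = ¬b b-recv
Dual-irreducible irr ¬b r-dsend    = ¬b b-send
Dual-irreducible irr ¬b (r-dext {ls} {Ts} e) = ¬b (b-ext {ls} {Ts} e)
Dual-irreducible irr ¬b (r-dint {ls} {Ts} e) = ¬b (b-int {ls} {Ts} e)
Dual-irreducible irr ¬b (r-dual r) = irr r
Dual-irreducible irr ¬b (r-dd {α} {Ts}) = ¬b (b-dvar {α} {Ts})

whnf-irreducible : ∀ {T} → Whnf T → Irreducible T
whnf-irreducible (w-con ι) ()
whnf-irreducible (w-capp ι T Ts ¬⨟ ¬μ ¬D) =
  apps-irreducible Ts (app λ { refl → ¬⨟ refl }) (con-app-irreducible ¬⨟ ¬μ ¬D)
whnf-irreducible (w-semi1 T) (r-app ())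
whnf-irreducible (w-semi T₁ T₂ Ts w ¬skip ¬seq) =
  apps-irreducible Ts (app λ ()) (seq-irreducible (whnf-irreducible w) ¬skip ¬seq)
whnf-irreducible (w-var α Ts) = apps-irreducible Ts (var α) λ ()
whnf-irreducible (w-lam α κ T) ()
whnf-irreducible (w-dual T Ts w ¬b) =
  apps-irreducible Ts (app λ ()) (Dual-irreducible (whnf-irreducible w) ¬b)

data Progress (T : Ty) : Set where
  whnf : Whnf T → Progress T
  step : ∀ {U} → T ⟶ U → Progress T

Dual-progress : ∀ {T} → Progress T → Progress (Dual T)
Dual-progress (step r) = step (r-dual r)
Dual-progress {T} (whnf w) with isDualBlocked? T
... | yes b  = step (proj₂ (blocked-Dual-reducible b))
... | no ¬b  = whnf (w-dual T [] w ¬b)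

con-injective : ∀ {c d} → con c ≡ con d → c ≡ d
con-injective refl = refl

whnf-seq : ∀ {T c} U → Whnf T → headOf T ≡ con c → c ≢ skipC → c ≢ semiC → Whnf (T ⨟ U)
whnf-seq U w h ¬skip ¬semi =
  w-semi _ U [] w (λ { refl → ¬skip (con-injective (sym h)) })
                  (λ { isSeq → ¬semi (con-injective (sym h)) })

-- Skip and sequences are among the Dual-blocked types, so isDualBlocked?
-- also decides the side conditions of w-semi.
seq-progress : ∀ {T} U → Progress T → Progress (T ⨟ U)
seq-progress U (step r) = step (r-seq r)
seq-progress {T} U (whnf w) with isDualBlocked? T
... | no ¬b                 = whnf (w-semi T U [] w (λ { refl → ¬b b-skip }) (λ { isSeq → ¬b b-seq }))
... | yes b-skip            = step r-skip
... | yes b-seq             = step r-assoc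
... | yes b-end             = whnf (whnf-seq U w refl (λ ()) (λ ()))
... | yes b-recv            = whnf (whnf-seq U w refl (λ ()) (λ ()))
... | yes b-send            = whnf (whnf-seq U w refl (λ ()) (λ ()))
... | yes b-dvar            = whnf (whnf-seq U w refl (λ ()) (λ ()))
... | yes (b-ext {Us = Us} _) = whnf (whnf-seq U w (headOf-apps _ Us) (λ ()) (λ ()))
... | yes (b-int {Us = Us} _) = whnf (whnf-seq U w (headOf-apps _ Us) (λ ()) (λ ()))

con-app-progress : ∀ c {U} → Progress U → Progress (app (con c) U)
con-app-progress semiC        _ = whnf (w-semi1 _)
con-app-progress (muC κ)      _ = step r-mu
con-app-progress dualC        p = Dual-progress p
con-app-progress arrowC       _ = whnf (w-capp _ _ [] (λ ()) (λ _ ()) (λ ()))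
con-app-progress (recordC _)  _ = whnf (w-capp _ _ [] (λ ()) (λ _ ()) (λ ()))
con-app-progress (variantC _) _ = whnf (w-capp _ _ [] (λ ()) (λ _ ()) (λ ()))
con-app-progress (forallC _)  _ = whnf (w-capp _ _ [] (λ ()) (λ _ ()) (λ ()))
con-app-progress skipC        _ = whnf (w-capp _ _ [] (λ ()) (λ _ ()) (λ ()))
con-app-progress endC         _ = whnf (w-capp _ _ [] (λ ()) (λ _ ()) (λ ()))
con-app-progress recvC        _ = whnf (w-capp _ _ [] (λ ()) (λ _ ()) (λ ()))
con-app-progress sendC        _ = whnf (w-capp _ _ [] (λ ()) (λ _ ()) (λ ()))
con-app-progress (extC _)     _ = whnf (w-capp _ _ [] (λ ()) (λ _ ()) (λ ()))
con-app-progress (intC _)     _ = whnf (w-capp _ _ [] (λ ()) (λ _ ()) (λ ()))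

whnf-app : ∀ {X} Y → Rigid X → Whnf X → Whnf (app X Y)
whnf-app Y ()       (w-con ι)
whnf-app Y _        (w-capp ι T Ts ¬⨟ ¬μ ¬D) =
  transport Whnf (apps-∷ʳ _ Ts Y) (w-capp ι T (Ts ∷ʳ Y) ¬⨟ ¬μ ¬D)
whnf-app Y (app ne) (w-semi1 T) with () ← ne refl
whnf-app Y _        (w-semi T₁ T₂ Ts w ¬skip ¬seq) =
  transport Whnf (apps-∷ʳ _ Ts Y) (w-semi T₁ T₂ (Ts ∷ʳ Y) w ¬skip ¬seq)
whnf-app Y _        (w-var α Ts) = transport Whnf (apps-∷ʳ _ Ts Y) (w-var α (Ts ∷ʳ Y))
whnf-app Y ()       (w-lam α κ T)
whnf-app Y _        (w-dual T Ts w ¬b) =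
  transport Whnf (apps-∷ʳ _ Ts Y) (w-dual T (Ts ∷ʳ Y) w ¬b)

data FunctionView : Ty → Set where
  con   : ∀ c → FunctionView (con c)
  lam   : ∀ α κ T → FunctionView (lam α κ T)
  seq₁  : ∀ T → FunctionView (app (con semiC) T)
  rigid : ∀ {X} → Rigid X → FunctionView X

functionView : ∀ {X} → Whnf X → FunctionView X
functionView (w-con ι)                  = con ι
functionView (w-capp ι T Ts ¬⨟ _ _)     = rigid (Rigid-apps Ts (app λ { refl → ¬⨟ refl }))
functionView (w-semi1 T)                = seq₁ T
functionView (w-semi T₁ T₂ Ts _ _ _)    = rigid (Rigid-apps Ts (app λ ()))
functionView (w-var α Ts)               = rigid (Rigid-apps Ts (var α))
functionView (w-lam α κ T)              = lam α κ T
functionView (w-dual T Ts _ _)          = rigid (Rigid-apps Ts (app λ ()))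

progress : ∀ T → Progress T
progress (con c)     = whnf (w-con c)
progress (var α)     = whnf (w-var α [])
progress (lam α κ T) = whnf (w-lam α κ T)
progress (app X Y) with progress X
... | step r = step (r-app r)
... | whnf w with functionView w
...   | con c     = con-app-progress c (progress Y)
...   | lam α κ T = step r-beta
...   | seq₁ T    = seq-progress Y (progress T)
...   | rigid ρ   = whnf (whnf-app Y ρ w)

irreducible⇒whnf : ∀ {T} → ¬ Reducible T → Whnf T
irreducible⇒whnf {T} ¬red with progress T
... | whnf w = w
... | step r with () ← ¬red (_ , r)

lemma1 : (T : Ty) → T ≡ rename T → (Whnf T ⇔ (¬ Σ Ty (λ U → T ⟶ U)))
lemma1 T _ = mk⇔ (λ w (_ , r) → whnf-irreducible w r) irreducible⇒whnf
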